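{- For every ecumenical formula of the form $A^c$ (with $A^i$ its intuitionistic counterpart), every ecumenical formula $B$ and every atomic system $S$, $\Vdash^L_S \big(((A^i\to B)^i\to A^i)^i\to A^c\big)^i$.
   Context: Basic setting. Let $\mathsf{At}$ be a countably infinite set of atomic propositions and $\mathsf{At}_\bot=\mathsf{At}\cup\{\bot\}$. An atomic rule has the form "from premises $p_1,\dots,p_n$ ($n\ge 0$) infer $p$", with $p_j,p\in\mathsf{At}_\bot$, where the derivation of each premise may discharge a set of basic sentences. An atomic system $S$ is a set of atomic rules; $S\subseteq S'$ ($S'$ extends $S$) if $S'$ contains all rules of $S$. $\Delta\vdash_S p$ means there is a natural-deduction derivation using only rules of $S$ with conclusion $p$ and undischarged assumptions in $\Delta$ (so $p\vdash_S p$). $S$ is consistent if $\nvdash_S\bot$. Standing convention: all atomic systems (including all extensions quantified over) are required to be consistent. Ecumenical formulas: $p^i,p^c$ for $p\in\mathsf{At}_\bot$; $(A\wedge B)^x,(A\vee B)^x,(A\to B)^x$ for $x\in\{i,c\}$. $\bot$ denotes $\bot^i$; for $X^c$, $X^i$ is the same construction with outer superscript $i$. Weak validity (by simultaneous recursion): (1) $\Vdash^L_S p^i$ iff $\vdash_S p$ ($p\in\mathsf{At}_\bot$); (2) $\Vdash^L_S p^c$ iff $p\nvdash_S\bot$; (3) for non-atomic $X$, $\Vdash^L_S X^c$ iff $X^i\nVdash^L_S\bot$; (4) $\Vdash^L_S(A\wedge B)^i$ iff $\Vdash^L_S A$ and $\Vdash^L_S B$; (5) $\Vdash^L_S(A\to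 B)^i$ iff $A\Vdash^G_S B$; (6) $\Vdash^L_S(A\vee B)^i$ iff for all $S'\supseteq S$ and all $p\in\mathsf{At}_\bot$, if $A\Vdash^L_{S'}p^i$ and $B\Vdash^L_{S'}p^i$ then $\Vdash^L_{S'}p^i$; (7) for nonempty $\Gamma$, $\Gamma\Vdash^L_S A$ iff for all $S'\supseteq S$, if $\Vdash^L_{S'}B$ for all $B\in\Gamma$ then $\Vdash^L_{S'}A$; (8) $\Gamma\Vdash^G_S A$ iff for all $S'\supseteq S$: if $\Vdash^L_{S''}B$ for all $B\in\Gamma$ and all $S''\supseteq S'$, then $\Vdash^L_{S''}A$ for all $S''\supseteq S'$. -}

module Defs where

open import Data.Nat using (ℕ)
open import Data.List using (List; []; _∷_; _++_)
open import Data.List.Membership.Propositional using (_∈_)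
open import Data.List.Relation.Unary.All using (All)
open import Data.Product using (_×_; _,_)
open import Relation.Nullary using (¬_)

-- Atomic propositions: At = ℕ (countably infinite), At⊥ = At ∪ {⊥}

data Atom : Set where
  bot : Atom
  at  : ℕ → Atom

-- Atomic rules: premises p₁ … pₙ (n ≥ 0), each paired with the (finite)
-- set of basic sentences its derivation may discharge; conclusion p.

record Rule : Set where
  constructor rule
  field
    premises   : List (List Atom × Atom)
    conclusion : Atom
open Rule public

System : Set₁
System = Rule → Set

_⊆ˢ_ : System → System → Set
S ⊆ˢ S' = ∀ r → S r → S' r

-- Natural-deduction derivability  Δ ⊢_S p  (undischarged assumptions in Δ).
data _⊢[_]_ (Δ : List Atom) (S : System) : Atom → Set₁ where
  ax  : ∀ {p} → p ∈ Δ → Δ ⊢[ S ] p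
  app : (r : Rule) → S r →
        All (λ { (Γ , q) → (Γ ++ Δ) ⊢[ S ] q }) (premises r) →
        Δ ⊢[ S ] conclusion r

Consistent : System → Set₁
Consistent S = ¬ ([] ⊢[ S ] bot)

-- Standing convention: all extensions quantified over are consistent.
_⊑_ : System → System → Set₁
S ⊑ S' = (S ⊆ˢ S') × Consistent S'

-- Ecumenical formulas:  X ^ t  with shape X and outer superscript t.

data Tag : Set where
  i c : Tag

mutual
  data Shape : Set where
    atom : Atom → Shape
    and  : Form → Form → Shape
    or   : Form → Form → Shape
    imp  : Form → Form → Shape

  data Form : Set where
    _^_ : Shape → Tag → Form

infix 30 _^_

VAt : System → Atom → Set₁
VAt S p = [] ⊢[ S ] p

mutual
  V : System → Form → Set₁
  V S (X ^ i)        = Vi S X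
  V S (atom p ^ c)   = ¬ ((p ∷ []) ⊢[ S ] bot)
  V S (and A B ^ c)  = ¬ (NegEnt S (and A B))
  V S (or A B ^ c)   = ¬ (NegEnt S (or A B))
  V S (imp A B ^ c)  = ¬ (NegEnt S (imp A B))

  -- X^i ⊩^L_S ⊥  (clause (7) with Γ = {X^i}, ⊥ = ⊥^i)
  NegEnt : System → Shape → Set₁
  NegEnt S X = ∀ S' → S ⊑ S' → Vi S' X → VAt S' bot

  Vi : System → Shape → Set₁
  Vi S (atom p)  = VAt S p
  Vi S (and A B) = V S A × V S B
  Vi S (imp A B) = G S A B
  Vi S (or A B)  =
    ∀ S' → S ⊑ S' → ∀ (p : Atom) →
      (∀ S'' → S' ⊑ S'' → V S'' A → VAt S'' p) →
      (∀ S'' → S' ⊑ S'' → V S'' B → VAt S'' p) →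
      VAt S' p

  -- A ⊩^G_S B  (clause (8) with Γ = {A})
  G : System → Form → Form → Set₁
  G S A B = ∀ S' → S ⊑ S' →
              (∀ S'' → S' ⊑ S'' → V S'' A) →
              (∀ S'' → S' ⊑ S'' → V S'' B)

-- A refutation of A^i (A^i ⊩ ⊥) makes (A^i → B)^i valid vacuously: in any consistent
-- extension where A^i is globally valid, ⊥ would be derivable. So the premise of
-- Peirce's law yields A^i, which refutes the refutation; by consistency A^i is not
-- refutable, which is exactly A^c. For an atom, p ⊢ ⊥ is turned into a refutation of
-- p^i by cutting with a proof of p.
module Submission where

open import Defs
open import Data.List using (List; []; _∷_; _++_)
open import Data.List.Membership.Propositional using (_∈_)
open import Data.List.Membership.Propositional.Properties using (∈-++⁻)
open import Data.List.Relation.Binary.Subset.Propositional using (_⊆_)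
open import Data.List.Relation.Binary.Subset.Propositional.Properties
  using (++⁺ʳ; xs⊆xs++ys; xs⊆ys++xs)
open import Data.List.Relation.Unary.All using (All; []; _∷_)
open import Data.List.Relation.Unary.Any using (here)
open import Data.Product using (_×_; _,_; proj₁; proj₂)
open import Data.Sum using (inj₁; inj₂)
open import Data.Empty using (⊥-elim)
open import Relation.Nullary using (¬_)
open import Relation.Binary.PropositionalEquality using (refl)

Premises : List Atom → System → List (List Atom × Atom) → Set₁
Premises Δ S = All (λ { (Γ , q) → (Γ ++ Δ) ⊢[ S ] q })

mutual
  ⊢-rename : ∀ {S Δ Δ' q} → Δ ⊆ Δ' → Δ ⊢[ S ] q → Δ' ⊢[ S ] q
  ⊢-rename ρ (ax x∈Δ)     = ax (ρ x∈Δ)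
  ⊢-rename ρ (app r s ds) = app r s (premises-rename ρ (premises r) ds)

  premises-rename : ∀ {S Δ Δ'} → Δ ⊆ Δ' → ∀ ps → Premises Δ S ps → Premises Δ' S ps
  premises-rename ρ []             []       = []
  premises-rename ρ ((Γ , q) ∷ ps) (d ∷ ds) =
    ⊢-rename (++⁺ʳ Γ ρ) d ∷ premises-rename ρ ps ds

Substitution : System → List Atom → List Atom → Set₁
Substitution S Δ Δ' = ∀ {x} → x ∈ Δ → Δ' ⊢[ S ] x

substitution-++ : ∀ {S Δ Δ'} Γ → Substitution S Δ Δ' → Substitution S (Γ ++ Δ) (Γ ++ Δ')
substitution-++ {Δ' = Δ'} Γ σ x∈Γ++Δ with ∈-++⁻ Γ x∈Γ++Δ
... | inj₁ x∈Γ = ax (xs⊆xs++ys Γ Δ' x∈Γ)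
... | inj₂ x∈Δ = ⊢-rename (xs⊆ys++xs Δ' Γ) (σ x∈Δ)

mutual
  ⊢-subst : ∀ {S S' Δ Δ' q} → S ⊆ˢ S' → Substitution S' Δ Δ' → Δ ⊢[ S ] q → Δ' ⊢[ S' ] q
  ⊢-subst S⊆S' σ (ax x∈Δ)     = σ x∈Δ
  ⊢-subst S⊆S' σ (app r s ds) = app r (S⊆S' r s) (premises-subst S⊆S' σ (premises r) ds)

  premises-subst : ∀ {S S' Δ Δ'} → S ⊆ˢ S' → Substitution S' Δ Δ' →
    ∀ ps → Premises Δ S ps → Premises Δ' S' ps
  premises-subst S⊆S' σ []             []       = []
  premises-subst S⊆S' σ ((Γ , q) ∷ ps) (d ∷ ds) =
    ⊢-subst S⊆S' (substitution-++ Γ σ) d ∷ premises-subst S⊆S' σ ps ds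

⊢-cut : ∀ {S S' p q} → S ⊆ˢ S' → [] ⊢[ S' ] p → (p ∷ []) ⊢[ S ] q → [] ⊢[ S' ] q
⊢-cut {S' = S'} {p} S⊆S' ⊢p = ⊢-subst S⊆S' σ
  where
  σ : Substitution S' (p ∷ []) []
  σ (here refl) = ⊢p

⊑-refl : ∀ {S} → Consistent S → S ⊑ S
⊑-refl S-consistent = (λ r s → s) , S-consistent

⊑-trans : ∀ {S₁ S₂ S₃} → S₁ ⊑ S₂ → S₂ ⊑ S₃ → S₁ ⊑ S₃
⊑-trans (S₁⊆S₂ , _) (S₂⊆S₃ , S₃-consistent) =
  (λ r s → S₂⊆S₃ r (S₁⊆S₂ r s)) , S₃-consistent

NegEnt-mono : ∀ {S S' X} → S ⊑ S' → NegEnt S X → NegEnt S' X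
NegEnt-mono S⊑S' refute S'' S'⊑S'' = refute S'' (⊑-trans S⊑S' S'⊑S'')

⊢⊥⇒NegEnt-atom : ∀ {S p} → (p ∷ []) ⊢[ S ] bot → NegEnt S (atom p)
⊢⊥⇒NegEnt-atom p⊢⊥ S' (S⊆S' , _) ⊢p = ⊢-cut S⊆S' ⊢p p⊢⊥

¬NegEnt⇒V-c : ∀ {S} X → ¬ NegEnt S X → V S (X ^ c)
¬NegEnt⇒V-c (atom p)  ¬refute = λ p⊢⊥ → ¬refute (⊢⊥⇒NegEnt-atom p⊢⊥)
¬NegEnt⇒V-c (and A B) ¬refute = ¬refute
¬NegEnt⇒V-c (or A B)  ¬refute = ¬refute
¬NegEnt⇒V-c (imp A B) ¬refute = ¬refute

NegEnt⇒Vi-imp : ∀ {S X} B → NegEnt S X → Vi S (imp (X ^ i) B)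
NegEnt⇒Vi-imp B refute S' (S⊆S' , S'-consistent) X-valid _ _ =
  ⊥-elim (S'-consistent (refute S' (S⊆S' , S'-consistent) (X-valid S' (⊑-refl S'-consistent))))

peirce-premise⇒¬NegEnt : ∀ {S} X B → Consistent S →
  V S (imp (imp (X ^ i) B ^ i) (X ^ i) ^ i) → ¬ NegEnt S X
peirce-premise⇒¬NegEnt {S} X B S-consistent premise refute =
  S-consistent (refute S S⊑S (premise S S⊑S imp-valid S S⊑S))
  where
  S⊑S : S ⊑ S
  S⊑S = ⊑-refl S-consistent
  imp-valid : ∀ S' → S ⊑ S' → V S' (imp (X ^ i) B ^ i)
  imp-valid S' S⊑S' = NegEnt⇒Vi-imp B (NegEnt-mono S⊑S' refute)

theorem9 : (A : Shape) (B : Form) (S : System) → Consistent S →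
    V S (imp (imp (imp (A ^ i) B ^ i) (A ^ i) ^ i) (A ^ c) ^ i)
theorem9 A B S _ S' _ premise S'' S'⊑S'' =
  ¬NegEnt⇒V-c A (peirce-premise⇒¬NegEnt A B (proj₂ S'⊑S'') (premise S'' S'⊑S''))
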